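{- Let $G$ be a finite non-cyclic abelian group with \[G\cong\mathbb{Z}_{p_1^{t_{11}}}\times\cdots\times\mathbb{Z}_{p_1^{t_{1k_1}}}\times\mathbb{Z}_{p_2^{t_{21}}}\times\cdots\times\mathbb{Z}_{p_2^{t_{2k_2}}}\times\cdots\times\mathbb{Z}_{p_r^{t_{r1}}}\times\cdots\times\mathbb{Z}_{p_r^{t_{rk_r}}},\] where $p_1,\dots,p_r$ are distinct primes, $k_i\ge 1$ and $1\le t_{i1}\le t_{i2}\le\cdots\le t_{ik_i}$ for all $i\in\{1,\dots,r\}$. Then \[\kappa(\mathcal{P}(G))\le p_1^{t_{11}}p_2^{t_{21}}\cdots p_r^{t_{r1}}-\phi\big(p_1^{t_{11}}p_2^{t_{21}}\cdots p_r^{t_{r1}}\big),\] where $\phi$ is Euler's totient function.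
   Context: For a finite group $G$, the power graph $\mathcal{P}(G)$ is the simple graph with vertex set $G$ in which two distinct vertices $u,v$ are adjacent iff $u^m=v$ or $v^m=u$ for some $m\in\mathbb{N}$. For a graph $\Gamma$, the vertex connectivity $\kappa(\Gamma)$ is the minimum number of vertices whose removal leaves an induced subgraph that is disconnected. -}

module Defs where

open import Data.Nat using (ℕ; zero; suc; _*_; _^_; _≤_)
open import Data.Nat.DivMod using (_mod_)
open import Data.Nat.GCD using (gcd)
open import Data.Fin using (Fin; toℕ)
open import Data.List using (List; []; _∷_; length; filter; map; upTo)
open import Data.List.Membership.Propositional using (_∈_)
open import Data.List.Relation.Unary.Unique.Propositional using (Unique)
open import Data.Product using (Σ; _×_; _,_; ∃; ∃-syntax)
open import Data.Sum using (_⊎_)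
open import Data.Unit using (⊤; tt)
open import Relation.Nullary using (¬_)
open import Relation.Binary.PropositionalEquality using (_≡_; _≢_)
import Data.Nat as N

φ : ℕ → ℕ
φ n = length (filter (λ m → gcd m n N.≟ 1) (map suc (upTo n)))

-- The finite abelian group  Z_{m₁} × ⋯ × Z_{m_s}  given by a list of moduli
-- (written additively, so the power u^m becomes the multiple m • u).

Elem : List ℕ → Set
Elem []       = ⊤
Elem (m ∷ ms) = Fin m × Elem ms

mulFin : ∀ {m} → ℕ → Fin m → Fin m
mulFin {suc m} n x = (n * toℕ x) mod (suc m)

_•_ : ∀ {ms} → ℕ → Elem ms → Elem ms
_•_ {[]}     n tt       = tt
_•_ {m ∷ ms} n (x , u) = mulFin n x , (n • u)

Cyclic : List ℕ → Set
Cyclic ms = ∃[ g ] ((x : Elem ms) → ∃[ n ] (n • g ≡ x))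

PowerAdj : ∀ {ms} → Elem ms → Elem ms → Set
PowerAdj u v = (u ≢ v) × (∃[ m ] ((1 ≤ m) × ((m • u ≡ v) ⊎ (m • v ≡ u))))

module _ {V : Set} (E : V → V → Set) where

  data ReachAvoiding (S : V → Set) : V → V → Set where
    here  : ∀ {u} → ¬ S u → ReachAvoiding S u u
    there : ∀ {u v w} → ¬ S u → E u v → ReachAvoiding S v w → ReachAvoiding S u w

  DisconnectedAfterRemoving : (V → Set) → Set
  DisconnectedAfterRemoving S =
    ∃[ u ] ∃[ v ] (¬ S u × ¬ S v × ¬ ReachAvoiding S u v)

  IsVertexCut : List V → Set
  IsVertexCut X = Unique X × DisconnectedAfterRemoving (_∈ X)

  IsVertexConnectivity : ℕ → Set
  IsVertexConnectivity k =
    (∃[ X ] (IsVertexCut X × length X ≡ k)) ×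
    ((X : List V) → IsVertexCut X → k ≤ length X)

module Submission where

-- Idea (as in the paper): let x ∈ G be 1 in the first factor of every p_i-block
-- and 0 elsewhere, so ⟨x⟩ is cyclic of order N.  A power-graph neighbour w of a
-- generator c of ⟨x⟩ lies in ⟨x⟩: either w = k•c, or k•w = c, and then k is
-- prime to every p_i (look at the first coordinate of each block), hence a unit
-- modulo |G|, so w is a multiple of c.  Removing the N − φ(N) non-generators of
-- ⟨x⟩ therefore leaves the generators of ⟨x⟩ cut off from the elements outside
-- ⟨x⟩, which exist because G is not cyclic.

open import Defs
open import Data.Nat using (ℕ; suc; _^_; _≤_; _∸_)
open import Data.Nat.Primality using (Prime)
open import Data.Fin using (Fin; zero)
open import Data.List using (List; concat; map; allFin)
open import Data.Nat.ListAction using (product)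
open import Data.Product using (_×_; ∃-syntax)
open import Relation.Nullary using (¬_)
open import Relation.Binary.PropositionalEquality using (_≡_)
import Data.Fin as F

open import Data.Nat
  using (zero; _+_; _*_; _<_; _%_; _/_; NonZero; z≤n; s≤s; _≟_; pred; >-nonZero⁻¹; nonTrivial⇒n>1)
open import Data.Nat.Properties
  using (≮⇒≥; anyUpTo?; ≤-trans; ≤-reflexive; *-assoc; *-identityˡ; *-identityʳ; *-distribʳ-+; *-zeroʳ; +-suc;
         m*n≢0; m+n∸m≡n; suc-pred; ^-monoʳ-<; m^n≢0; <⇒≢; module ≤-Reasoning)
open import Data.Nat.Induction using (<-rec)
open import Data.Nat.DivMod using (m%n<n; m<n⇒m%n≡m; %-distribˡ-*; m%n%n≡m%n; %-remove-+ʳ; m≡m%n+[m/n]*n)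
open import Data.Nat.Divisibility using (_∣_; ∣-trans; m∣m*n; ∣m⇒∣m*n; ∣n⇒∣m*n; %-presˡ-∣; ∣n∣m%n⇒∣m)
open import Data.Nat.GCD using (gcd; gcd-zeroˡ; module Bézout)
open import Data.Nat.Coprimality using (Coprime; coprime-Bézout; coprime-divisor; 1-coprimeTo; gcd≡1⇒coprime)
import Data.Nat.Coprimality as Coprimality
open import Data.Nat.Primality using (prime⇒irreducible; prime⇒nonZero; prime⇒nonTrivial)
open import Data.Nat.ListAction.Properties using (∈⇒∣product; product≢0)
open import Data.Nat.Tactic.RingSolver using (solve-∀)
open import Data.Fin using (toℕ; fromℕ<)
open import Data.Fin.Properties using (toℕ-injective; toℕ-fromℕ<; toℕ<n)
open import Data.List using ([]; _∷_; _++_; length; upTo; filter; deduplicate; cartesianProduct)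
open import Data.List.Properties using (length-map; length-upTo; length-filter; length-deduplicate)
open import Data.List.Membership.Propositional using (_∈_; find; lose)
open import Data.List.Membership.Propositional.Properties
  using (∈-map⁺; ∈-map⁻; ∈-++⁺ˡ; ∈-++⁺ʳ; ∈-cartesianProduct⁺; ∈-cartesianProduct⁻; ∈-upTo⁺; ∈-allFin;
         ∈-filter⁺; ∈-filter⁻; ∈-deduplicate⁺; ∈-deduplicate⁻)
open import Data.List.Relation.Unary.Any as Any using (Any; here; there; any?)
open import Data.List.Relation.Unary.All as All using (All; []; _∷_; all?)
import Data.List.Relation.Unary.All.Properties as All
open import Data.List.Relation.Unary.Unique.DecPropositional.Properties using (deduplicate-!)
open import Data.Product using (_,_; proj₁; proj₂)
open import Data.Product.Properties using (≡-dec)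
open import Data.Sum using (_⊎_; inj₁; inj₂)
open import Data.Unit using (tt)
open import Function using (_∘_)
open import Relation.Nullary using (Dec; yes; no; ¬?; _×-dec_; _→-dec_; _⊎-dec_)
open import Relation.Nullary.Decidable using (decidable-stable; ¬¬-excluded-middle)
open import Relation.Nullary.Negation using (¬¬-map; contradiction)
open import Relation.Binary.Definitions using (DecidableEquality)
open import Relation.Binary.PropositionalEquality
  using (refl; sym; trans; cong; cong₂; subst; module ≡-Reasoning)

least : (P : ℕ → Set) → (∀ n → Dec (P n)) →
        ∀ K → P K → ∃[ k ] (P k × (∀ j → j < k → ¬ P j))
least P P? = <-rec (λ K → P K → Least) lower
  where
  Least : Set
  Least = ∃[ k ] (P k × (∀ j → j < k → ¬ P j))

  lower : ∀ K → (∀ {j} → j < K → P j → Least) → P K → Least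
  lower K below pK with anyUpTo? P? K
  ... | yes (j , j<K , pj) = below j<K pj
  ... | no none            = K , pK , λ j j<K pj → none (j , j<K , pj)

reach-start : ∀ {V : Set} {E : V → V → Set} {S u w} → ReachAvoiding E S u w → ¬ S u
reach-start (here ¬Su)      = ¬Su
reach-start (there ¬Su _ _) = ¬Su

-- Whether removing X disconnects the graph
-- is decided by searching for a "separating set" C ⊆ V (containing u, missing
-- v, closed under edges into V ∖ X); such a set exists iff v is unreachable
-- from u, the converse holding because the goal is decidable (so the classical
-- choice C = {w | u reaches w} may be used under double negation).
module FiniteGraph {V : Set} (_≟_ : DecidableEquality V) (Vs : List V)
                   (complete : ∀ v → v ∈ Vs)
                   (E : V → V → Set) (E? : ∀ u v → Dec (E u v)) where

  open import Data.List.Membership.DecPropositional _≟_ using (_∈?_)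
  open import Data.List.Relation.Unary.Unique.DecPropositional _≟_ using (unique?)

  Reach : (V → Set) → V → V → Set
  Reach = ReachAvoiding E

  sublists : List V → List (List V)
  sublists []       = [] ∷ []
  sublists (x ∷ xs) = map (x ∷_) (sublists xs) ++ sublists xs

  listsOfLength : ℕ → List (List V)
  listsOfLength zero    = [] ∷ []
  listsOfLength (suc k) = map (λ (v , X) → v ∷ X) (cartesianProduct Vs (listsOfLength k))

  listsOfLength-length : ∀ k {X} → X ∈ listsOfLength k → length X ≡ k
  listsOfLength-length zero    (here refl) = refl
  listsOfLength-length (suc k) X∈ with ∈-map⁻ _ X∈
  ... | (v , Y) , vY∈ , refl = cong suc (listsOfLength-length k (proj₂ (∈-cartesianProduct⁻ Vs _ vY∈)))

  listsOfLength-complete : ∀ X → X ∈ listsOfLength (length X)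
  listsOfLength-complete []      = here refl
  listsOfLength-complete (v ∷ X) = ∈-map⁺ _ (∈-cartesianProduct⁺ (complete v) (listsOfLength-complete X))

  Closed : List V → List V → Set
  Closed X C = All (λ c → All (λ w → c ∈ C → ¬ w ∈ X → E c w → w ∈ C) Vs) Vs

  Separates : List V → V → V → List V → Set
  Separates X u v C = ¬ u ∈ X × ¬ v ∈ X × u ∈ C × ¬ v ∈ C × Closed X C

  Separable : List V → Set
  Separable X = Any (λ u → Any (λ v → Any (Separates X u v) (sublists Vs)) Vs) Vs

  separable? : ∀ X → Dec (Separable X)
  separable? X = any? (λ u → any? (λ v → any? (λ C →
      ¬? (u ∈? X) ×-dec ¬? (v ∈? X) ×-dec (u ∈? C) ×-dec ¬? (v ∈? C) ×-dec
      all? (λ c → all? (λ w → (c ∈? C) →-dec (¬? (w ∈? X) →-dec (E? c w →-dec (w ∈? C)))) Vs) Vs)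
    (sublists Vs)) Vs) Vs

  reach-snoc : ∀ {S u c w} → Reach S u c → ¬ S w → E c w → Reach S u w
  reach-snoc (here ¬Su)        ¬Sw e′ = there ¬Su e′ (here ¬Sw)
  reach-snoc (there ¬Su e rch) ¬Sw e′ = there ¬Su e (reach-snoc rch ¬Sw e′)

  closed-reach : ∀ {X C u w} → Closed X C → u ∈ C → Reach (_∈ X) u w → w ∈ C
  closed-reach cl u∈C (here _)        = u∈C
  closed-reach {u = u} cl u∈C (there _ e rch) =
    closed-reach cl (All.lookup (All.lookup cl (complete u)) (complete _) u∈C (reach-start rch) e) rch

  separable⇒disconnected : ∀ X → Separable X → DisconnectedAfterRemoving E (_∈ X)
  separable⇒disconnected X sep with Any.satisfied sep
  ... | u , sep-u with Any.satisfied sep-u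
  ... | v , sep-uv with Any.satisfied sep-uv
  ... | C , ¬u∈X , ¬v∈X , u∈C , ¬v∈C , cl = u , v , ¬u∈X , ¬v∈X , ¬v∈C ∘ closed-reach cl u∈C

  sublist-realises : (P : V → Set) → ∀ l →
    ¬ ¬ (∃[ C ] (C ∈ sublists l × (∀ w → w ∈ C → P w) × (∀ w → w ∈ l → P w → w ∈ C)))
  sublist-realises P []       = λ k → k ([] , here refl , (λ _ ()) , λ _ ())
  sublist-realises P (x ∷ xs) k = sublist-realises P xs λ (C , C∈ , sound , compl) →
    ¬¬-excluded-middle λ P?x → k (extend C C∈ sound compl P?x)
    where
    extend : ∀ C → C ∈ sublists xs → (∀ w → w ∈ C → P w) → (∀ w → w ∈ xs → P w → w ∈ C) → Dec (P x) →
             ∃[ C′ ] (C′ ∈ sublists (x ∷ xs) × (∀ w → w ∈ C′ → P w) × (∀ w → w ∈ x ∷ xs → P w → w ∈ C′))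
    extend C C∈ sound compl (yes px) = x ∷ C , ∈-++⁺ˡ (∈-map⁺ _ C∈) ,
      (λ { _ (here refl) → px ; w (there w∈) → sound w w∈ }) ,
      (λ { _ (here refl) _ → here refl ; w (there w∈) pw → there (compl w w∈ pw) })
    extend C C∈ sound compl (no ¬px) = C , ∈-++⁺ʳ (map (x ∷_) (sublists xs)) C∈ , sound ,
      (λ { _ (here refl) px → contradiction px ¬px ; w (there w∈) pw → compl w w∈ pw })

  -- the converse: the set of vertices reachable from u separates u from v,
  -- and since Separable X is decidable the double negation can be removed
  disconnected⇒separable : ∀ X → DisconnectedAfterRemoving E (_∈ X) → Separable X
  disconnected⇒separable X (u , v , ¬u∈X , ¬v∈X , ¬reach) =
    decidable-stable (separable? X) (¬¬-map separate (sublist-realises (Reach (_∈ X) u) Vs))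
    where
    separate : ∃[ C ] (C ∈ sublists Vs × (∀ w → w ∈ C → Reach (_∈ X) u w) ×
                       (∀ w → w ∈ Vs → Reach (_∈ X) u w → w ∈ C)) →
               Separable X
    separate (C , C∈ , sound , compl) =
      Any.map (λ { refl → Any.map (λ { refl → Any.map (λ { refl → sep }) C∈ }) (complete v) })
              (complete u)
      where
      sep : Separates X u v C
      sep = ¬u∈X , ¬v∈X , compl u (complete u) (here ¬u∈X) , ¬reach ∘ sound v ,
            All.tabulate λ {c} _ → All.tabulate λ {w} _ c∈C ¬w∈X e →
              compl w (complete w) (reach-snoc (sound c c∈C) ¬w∈X e)

  cut? : ∀ X → Dec (IsVertexCut E X)
  cut? X with unique? X | separable? X
  ... | yes u | yes s = yes (u , separable⇒disconnected X s)
  ... | no ¬u | _     = no (¬u ∘ proj₁)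
  ... | _     | no ¬s = no (¬s ∘ disconnected⇒separable X ∘ proj₂)

  CutOfSize : ℕ → Set
  CutOfSize k = ∃[ X ] (IsVertexCut E X × length X ≡ k)

  cutOfSize? : ∀ k → Dec (CutOfSize k)
  cutOfSize? k with any? cut? (listsOfLength k)
  ... | yes some = let (X , X∈ , cut) = find some in yes (X , cut , listsOfLength-length k X∈)
  ... | no none  = no λ { (X , cut , refl) →
    none (Any.map (λ { refl → cut }) (listsOfLength-complete X)) }

  connectivity-exists : ∀ X₀ → IsVertexCut E X₀ → ∃[ κ ] (IsVertexConnectivity E κ × κ ≤ length X₀)
  connectivity-exists X₀ cut₀ with least CutOfSize cutOfSize? (length X₀) (X₀ , cut₀ , refl)
  ... | κ , cutκ , noSmaller = κ , (cutκ , minimal) , minimal X₀ cut₀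
    where
    minimal : ∀ X → IsVertexCut E X → κ ≤ length X
    minimal X cut = ≮⇒≥ λ lt → noSmaller (length X) lt (X , cut , refl)

toℕ-mulFin : ∀ {M} .{{_ : NonZero M}} n (y : Fin M) → toℕ (mulFin n y) ≡ (n * toℕ y) % M
toℕ-mulFin {suc M} n y = toℕ-fromℕ< (m%n<n (n * toℕ y) (suc M))

%-absorbʳ : ∀ a z M .{{_ : NonZero M}} → (a * (z % M)) % M ≡ (a * z) % M
%-absorbʳ a z M = begin
  (a * (z % M)) % M            ≡⟨ %-distribˡ-* a (z % M) M ⟩
  ((a % M) * (z % M % M)) % M  ≡⟨ cong (λ q → ((a % M) * q) % M) (m%n%n≡m%n z M) ⟩
  ((a % M) * (z % M)) % M      ≡⟨ %-distribˡ-* a z M ⟨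
  (a * z) % M                  ∎
  where open ≡-Reasoning

mulFin-assoc : ∀ {M} a b (y : Fin M) → mulFin (a * b) y ≡ mulFin a (mulFin b y)
mulFin-assoc {suc M} a b y = toℕ-injective (begin
  toℕ (mulFin (a * b) y)               ≡⟨ toℕ-mulFin (a * b) y ⟩
  (a * b * toℕ y) % suc M              ≡⟨ cong (_% suc M) (*-assoc a b (toℕ y)) ⟩
  (a * (b * toℕ y)) % suc M            ≡⟨ %-absorbʳ a (b * toℕ y) (suc M) ⟨
  (a * ((b * toℕ y) % suc M)) % suc M  ≡⟨ cong (λ q → (a * q) % suc M) (toℕ-mulFin b y) ⟨
  (a * toℕ (mulFin b y)) % suc M       ≡⟨ toℕ-mulFin a (mulFin b y) ⟨
  toℕ (mulFin a (mulFin b y))          ∎)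
  where open ≡-Reasoning

mulFin-one : ∀ {M} (y : Fin M) → mulFin 1 y ≡ y
mulFin-one {suc M} y = toℕ-injective (begin
  toℕ (mulFin 1 y)       ≡⟨ toℕ-mulFin 1 y ⟩
  (1 * toℕ y) % suc M    ≡⟨ cong (_% suc M) (*-identityˡ (toℕ y)) ⟩
  toℕ y % suc M          ≡⟨ m<n⇒m%n≡m (toℕ<n y) ⟩
  toℕ y                  ∎)
  where open ≡-Reasoning

mulFin-periodic : ∀ {M} L → M ∣ L → (y : Fin M) → ∀ n j → mulFin (n + j * L) y ≡ mulFin n y
mulFin-periodic {suc M} L M∣L y n j = toℕ-injective (begin
  toℕ (mulFin (n + j * L) y)           ≡⟨ toℕ-mulFin (n + j * L) y ⟩
  ((n + j * L) * toℕ y) % suc M        ≡⟨ cong (_% suc M) (*-distribʳ-+ (toℕ y) n (j * L)) ⟩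
  (n * toℕ y + j * L * toℕ y) % suc M  ≡⟨ %-remove-+ʳ (n * toℕ y) (∣m⇒∣m*n (toℕ y) (∣n⇒∣m*n j M∣L)) ⟩
  (n * toℕ y) % suc M                  ≡⟨ toℕ-mulFin n y ⟨
  toℕ (mulFin n y)                     ∎)
  where open ≡-Reasoning

•-assoc : ∀ {ms} a b (w : Elem ms) → (a * b) • w ≡ a • (b • w)
•-assoc {[]}     a b tt      = refl
•-assoc {m ∷ ms} a b (y , w) = cong₂ _,_ (mulFin-assoc a b y) (•-assoc a b w)

•-one : ∀ {ms} (w : Elem ms) → 1 • w ≡ w
•-one {[]}     tt      = refl
•-one {m ∷ ms} (y , w) = cong₂ _,_ (mulFin-one y) (•-one w)

Periodic : ∀ {ms} → ℕ → Elem ms → Set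
Periodic L w = ∀ n j → (n + j * L) • w ≡ n • w

periodic-common-multiple : ∀ {ms} L → All (_∣ L) ms → (w : Elem ms) → Periodic L w
periodic-common-multiple {[]}     L []          tt      n j = refl
periodic-common-multiple {m ∷ ms} L (m∣L ∷ ∣L) (y , w) n j =
  cong₂ _,_ (mulFin-periodic L m∣L y n j) (periodic-common-multiple L ∣L w n j)

periodic-product : ∀ {ms} (w : Elem ms) → Periodic (product ms) w
periodic-product {ms} = periodic-common-multiple (product ms) (All.tabulate ∈⇒∣product)

•-reduce : ∀ {ms} L .{{_ : NonZero L}} (w : Elem ms) → Periodic L w →
           ∀ n → suc n • w ≡ suc (n % L) • w
•-reduce L w per n = begin
  suc n • w                        ≡⟨ cong (λ q → suc q • w) (m≡m%n+[m/n]*n n L) ⟩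
  (suc (n % L) + (n / L) * L) • w  ≡⟨ per (suc (n % L)) (n / L) ⟩
  suc (n % L) • w                  ∎
  where open ≡-Reasoning

elements : ∀ ms → List (Elem ms)
elements []       = tt ∷ []
elements (m ∷ ms) = cartesianProduct (allFin m) (elements ms)

elements-complete : ∀ {ms} (w : Elem ms) → w ∈ elements ms
elements-complete {[]}     tt      = here refl
elements-complete {m ∷ ms} (y , w) = ∈-cartesianProduct⁺ (∈-allFin y) (elements-complete w)

infix 4 _≟ᴱ_
_≟ᴱ_ : ∀ {ms} → DecidableEquality (Elem ms)
_≟ᴱ_ {[]}     tt tt = yes refl
_≟ᴱ_ {m ∷ ms} = ≡-dec F._≟_ _≟ᴱ_

order-nonZero : ∀ {ms} → Elem ms → NonZero (product ms)
order-nonZero {[]}         tt      = _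
order-nonZero {suc m ∷ ms} (y , w) = m*n≢0 (suc m) (product ms) {{_}} {{order-nonZero w}}

-- adjacency in the power graph is decidable: multipliers may be taken in {1, …, |G|}
powerAdj? : ∀ {ms} (u v : Elem ms) → Dec (PowerAdj u v)
powerAdj? {ms} u v = ¬? (u ≟ᴱ v) ×-dec power?
  where
  instance _ = order-nonZero u
  L = product ms
  Rel : ℕ → Set
  Rel m = (m • u ≡ v) ⊎ (m • v ≡ u)
  reduce : ∀ n → Rel (suc n) → Rel (suc (n % L))
  reduce n (inj₁ e) = inj₁ (trans (sym (•-reduce L u (periodic-product u) n)) e)
  reduce n (inj₂ e) = inj₂ (trans (sym (•-reduce L v (periodic-product v) n)) e)
  power? : Dec (∃[ m ] ((1 ≤ m) × Rel m))
  power? with any? (λ m → (m • u ≟ᴱ v) ⊎-dec (m • v ≟ᴱ u)) (map suc (upTo L))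
  ... | yes found with find found
  ...   | m , m∈ , rel with ∈-map⁻ suc m∈
  ...     | _ , _ , refl = yes (m , s≤s z≤n , rel)
  power? | no none = no λ { (suc n , _ , rel) →
    none (lose (∈-map⁺ suc (∈-upTo⁺ (m%n<n n L))) (reduce n rel)) }

append : ∀ xs {ys} → Elem xs → Elem ys → Elem (xs ++ ys)
append []       tt      b = b
append (x ∷ xs) (a , u) b = a , append xs u b

split : ∀ xs {ys} → Elem (xs ++ ys) → Elem xs × Elem ys
split []       w       = tt , w
split (x ∷ xs) (a , w) = let (u , v) = split xs w in (a , u) , v

append-split : ∀ xs {ys} (w : Elem (xs ++ ys)) →
               append xs (proj₁ (split xs w)) (proj₂ (split xs w)) ≡ w
append-split []       w       = refl
append-split (x ∷ xs) (a , w) = cong (a ,_) (append-split xs w)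

split-append : ∀ xs {ys} (a : Elem xs) (b : Elem ys) → split xs (append xs a b) ≡ (a , b)
split-append []       tt      b = refl
split-append (x ∷ xs) (a , u) b rewrite split-append xs u b = refl

append-injective : ∀ xs {ys} {a a′ : Elem xs} {b b′ : Elem ys} →
                   append xs a b ≡ append xs a′ b′ → a ≡ a′ × b ≡ b′
append-injective xs {a = a} {a′} {b} {b′} eq
  with trans (sym (split-append xs a b)) (trans (cong (split xs) eq) (split-append xs a′ b′))
... | refl = refl , refl

•-append : ∀ xs {ys} n (a : Elem xs) (b : Elem ys) → n • append xs a b ≡ append xs (n • a) (n • b)
•-append []       n tt      b = refl
•-append (x ∷ xs) n (a , u) b = cong (mulFin n a ,_) (•-append xs n u b)

periodic-append : ∀ xs {ys} L (a : Elem xs) (b : Elem ys) →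
                  Periodic L a → Periodic L b → Periodic L (append xs a b)
periodic-append xs L a b per-a per-b n j = begin
  (n + j * L) • append xs a b                    ≡⟨ •-append xs (n + j * L) a b ⟩
  append xs ((n + j * L) • a) ((n + j * L) • b)  ≡⟨ cong₂ (append xs) (per-a n j) (per-b n j) ⟩
  append xs (n • a) (n • b)                      ≡⟨ •-append xs n a b ⟨
  n • append xs a b                              ∎
  where open ≡-Reasoning

zeroᴱ : ∀ ms → All NonZero ms → Elem ms
zeroᴱ []           []         = tt
zeroᴱ (suc m ∷ ms) (_ ∷ nz) = F.zero , zeroᴱ ms nz

•-zeroᴱ : ∀ ms (nz : All NonZero ms) n → n • zeroᴱ ms nz ≡ zeroᴱ ms nz
•-zeroᴱ []           []       n = refl
•-zeroᴱ (suc m ∷ ms) (_ ∷ nz) n = cong₂ _,_ (toℕ-injective (begin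
  toℕ (mulFin n (F.zero {m}))  ≡⟨ toℕ-mulFin n F.zero ⟩
  (n * 0) % suc m              ≡⟨ cong (_% suc m) (*-zeroʳ n) ⟩
  0                            ∎)) (•-zeroᴱ ms nz n)
  where open ≡-Reasoning

coprime-* : ∀ {k a b} → Coprime k a → Coprime k b → Coprime k (a * b)
coprime-* {k} {a} ka kb (d∣k , d∣ab) = kb (d∣k , coprime-divisor da d∣ab)
  where
  da : Coprime _ a
  da (e∣d , e∣a) = ka (∣-trans e∣d d∣k , e∣a)

coprime-product : ∀ {k} ms → All (Coprime k) ms → Coprime k (product ms)
coprime-product {k} []       []        = Coprimality.sym (1-coprimeTo k)
coprime-product     (m ∷ ms) (km ∷ kms) = coprime-* km (coprime-product ms kms)

coprime-^ : ∀ {k a} → Coprime k a → ∀ e → Coprime k (a ^ e)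
coprime-^ {k} ka zero    = Coprimality.sym (1-coprimeTo k)
coprime-^     ka (suc e) = coprime-* ka (coprime-^ ka e)

∤-prime⇒coprime : ∀ {k p} → Prime p → ¬ p ∣ k → Coprime k p
∤-prime⇒coprime pp p∤k (d∣k , d∣p) with prime⇒irreducible pp d∣p
... | inj₁ d≡1 = d≡1
... | inj₂ refl = contradiction d∣k p∤k

-- A multiplier coprime to |G| acts invertibly: Bézout gives  x k ≡ ±1 (mod |G|),
-- and in the "−1" case  (x² k) k ≡ 1 (mod |G|)  by the identity below.
square-trick : ∀ x k y L → 1 + x * k ≡ y * L → x * x * k * k + 2 * y * L ≡ 1 + y * y * L * L
square-trick x k y L eq = begin
  x * x * k * k + 2 * y * L            ≡⟨ lhs x k y L ⟩
  (x * k) * (x * k) + 2 * (y * L)      ≡⟨ cong (λ q → (x * k) * (x * k) + 2 * q) eq ⟨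
  (x * k) * (x * k) + 2 * (1 + x * k)  ≡⟨ square-shift (x * k) ⟩
  1 + (1 + x * k) * (1 + x * k)        ≡⟨ cong (λ q → 1 + q * q) eq ⟩
  1 + (y * L) * (y * L)                ≡⟨ rhs y L ⟩
  1 + y * y * L * L                    ∎
  where
  open ≡-Reasoning
  lhs : ∀ x k y L → x * x * k * k + 2 * y * L ≡ (x * k) * (x * k) + 2 * (y * L)
  lhs = solve-∀
  square-shift : ∀ a → a * a + 2 * (1 + a) ≡ 1 + (1 + a) * (1 + a)
  square-shift = solve-∀
  rhs : ∀ y L → 1 + (y * L) * (y * L) ≡ 1 + y * y * L * L
  rhs = solve-∀

unit-inverse : ∀ {ms} k (w : Elem ms) → Coprime k (product ms) → ∃[ k′ ] ((k′ * k) • w ≡ w)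
unit-inverse {ms} k w k⊥L with coprime-Bézout k⊥L
... | Bézout.+- x y 1+yL≡xk = x , (begin
  (x * k) • w              ≡⟨ cong (_• w) 1+yL≡xk ⟨
  (1 + y * product ms) • w ≡⟨ periodic-product w 1 y ⟩
  1 • w                    ≡⟨ •-one w ⟩
  w                        ∎)
  where open ≡-Reasoning
... | Bézout.-+ x y 1+xk≡yL = x * x * k , (begin
  (x * x * k * k) • w                         ≡⟨ periodic-product w (x * x * k * k) (2 * y) ⟨
  (x * x * k * k + 2 * y * product ms) • w    ≡⟨ cong (_• w) (square-trick x k y (product ms) 1+xk≡yL) ⟩
  (1 + y * y * product ms * product ms) • w   ≡⟨ periodic-product w 1 (y * y * product ms) ⟩
  1 • w                                       ≡⟨ •-one w ⟩
  w                                           ∎)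
  where open ≡-Reasoning

length-filter-complement : ∀ {A : Set} {P : A → Set} (P? : ∀ a → Dec (P a)) xs →
  length (filter P? xs) + length (filter (¬? ∘ P?) xs) ≡ length xs
length-filter-complement P? []       = refl
length-filter-complement P? (a ∷ xs) with P? a
... | yes _ = cong suc (length-filter-complement P? xs)
... | no _  = trans (+-suc _ _) (cong suc (length-filter-complement P? xs))

-- Let x have period N and be "rigid": whenever k • w is a generator
-- m • x (gcd m N = 1) of ⟨x⟩, k is a unit modulo |G|.  Then every neighbour of
-- a generator of ⟨x⟩ lies in ⟨x⟩, so the non-generators of ⟨x⟩ — at most
-- N − φ(N) elements — separate x from any element outside ⟨x⟩.
module CyclicSubgroupCut {ms : List ℕ} (N : ℕ) {{_ : NonZero N}} (x : Elem ms)
    (x-periodic : Periodic N x)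
    (x-rigid : ∀ k m w → k • w ≡ m • x → gcd m N ≡ 1 → Coprime k (product ms)) where

  multipliers : List ℕ
  multipliers = map suc (upTo N)

  InSpan : Elem ms → Set
  InSpan y = Any (λ m → m • x ≡ y) multipliers

  unit? : ∀ m → Dec (gcd m N ≡ 1)
  unit? m = gcd m N ≟ 1

  Generator : Elem ms → Set
  Generator y = Any (λ m → gcd m N ≡ 1 × m • x ≡ y) multipliers

  generator? : ∀ y → Dec (Generator y)
  generator? y = any? (λ m → unit? m ×-dec (m • x ≟ᴱ y)) multipliers

  nonUnits : List ℕ
  nonUnits = filter (¬? ∘ unit?) multipliers

  nonUnitMultiples : List (Elem ms)
  nonUnitMultiples = map (_• x) nonUnits

  candidates : List (Elem ms)
  candidates = filter (¬? ∘ generator?) nonUnitMultiples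

  cut : List (Elem ms)
  cut = deduplicate _≟ᴱ_ candidates

  multiple-inSpan : ∀ n → InSpan (n • x)
  multiple-inSpan zero = lose (∈-map⁺ suc (∈-upTo⁺ (≤-reflexive (suc-pred N)))) (begin
    suc (pred N) • x   ≡⟨ cong (_• x) (trans (suc-pred N) (sym (*-identityˡ N))) ⟩
    (0 + 1 * N) • x    ≡⟨ x-periodic 0 1 ⟩
    0 • x              ∎)
    where open ≡-Reasoning
  multiple-inSpan (suc n) =
    lose (∈-map⁺ suc (∈-upTo⁺ (m%n<n n N))) (sym (•-reduce N x x-periodic n))

  x-generator : Generator x
  x-generator = lose (∈-map⁺ suc (∈-upTo⁺ (>-nonZero⁻¹ N))) (gcd-zeroˡ N , •-one x)

  generator-neighbour-inSpan : ∀ {c w} → Generator c → PowerAdj c w → InSpan w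
  generator-neighbour-inSpan gen-c (_ , k , _ , rel) with find gen-c
  ... | m , _ , (m⊥N , refl) with rel
  ...   | inj₁ k•c≡w = subst InSpan (trans (•-assoc k m x) k•c≡w) (multiple-inSpan (k * m))
  ...   | inj₂ k•w≡c with unit-inverse k _ (x-rigid k m _ k•w≡c m⊥N)
  ...     | k′ , k′k•w≡w = subst InSpan (begin
    (k′ * m) • x        ≡⟨ •-assoc k′ m x ⟩
    k′ • (m • x)        ≡⟨ cong (k′ •_) k•w≡c ⟨
    k′ • (k • _)        ≡⟨ •-assoc k′ k _ ⟨
    (k′ * k) • _        ≡⟨ k′k•w≡w ⟩
    _                   ∎) (multiple-inSpan (k′ * m))
    where open ≡-Reasoning

  cut-member : ∀ {y} → y ∈ cut → y ∈ nonUnitMultiples × ¬ Generator y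
  cut-member y∈ = ∈-filter⁻ (¬? ∘ generator?) {xs = nonUnitMultiples} (∈-deduplicate⁻ _≟ᴱ_ candidates y∈)

  cut⊆span : ∀ {y} → y ∈ cut → InSpan y
  cut⊆span y∈ with ∈-map⁻ (_• x) (proj₁ (cut-member y∈))
  ... | m , m∈ , refl = lose (proj₁ (∈-filter⁻ (¬? ∘ unit?) m∈)) refl

  generator∉cut : ∀ {y} → Generator y → ¬ y ∈ cut
  generator∉cut gen-y y∈ = proj₂ (cut-member y∈) gen-y

  span∖cut⊆generators : ∀ {y} → InSpan y → ¬ y ∈ cut → Generator y
  span∖cut⊆generators {y} inSpan y∉ with generator? y
  ... | yes gen-y = gen-y
  ... | no ¬gen-y with find inSpan
  ...   | m , m∈ , refl with unit? m
  ...     | yes m⊥N = lose m∈ (m⊥N , refl)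
  ...     | no ¬m⊥N = contradiction (∈-deduplicate⁺ _≟ᴱ_ (∈-filter⁺ (¬? ∘ generator?) m•x∈ ¬gen-y)) y∉
    where
    m•x∈ : m • x ∈ nonUnitMultiples
    m•x∈ = ∈-map⁺ (_• x) (∈-filter⁺ (¬? ∘ unit?) m∈ ¬m⊥N)

  walk-from-generator : ∀ {u w} → ReachAvoiding PowerAdj (_∈ cut) u w → Generator u → Generator w
  walk-from-generator (here _)          gen-u = gen-u
  walk-from-generator (there _ adj walk) gen-u =
    walk-from-generator walk
      (span∖cut⊆generators (generator-neighbour-inSpan gen-u adj) (reach-start walk))

  inSpan? : ∀ y → Dec (InSpan y)
  inSpan? y = any? (λ m → m • x ≟ᴱ y) multipliers

  outside-span : ¬ Cyclic ms → ∃[ v ] ¬ InSpan v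
  outside-span ¬cyclic with any? (¬? ∘ inSpan?) (elements ms)
  ... | yes outside = let (v , _ , ¬inSpan-v) = find outside in v , ¬inSpan-v
  ... | no none     = contradiction (x , generates) ¬cyclic
    where
    generates : ∀ y → ∃[ n ] (n • x ≡ y)
    generates y with inSpan? y
    ... | yes inSpan-y = let (m , _ , m•x≡y) = find inSpan-y in m , m•x≡y
    ... | no ¬inSpan-y = contradiction (lose (elements-complete y) ¬inSpan-y) none

  cut-isVertexCut : ¬ Cyclic ms → IsVertexCut PowerAdj cut
  cut-isVertexCut ¬cyclic = let (v , ¬inSpan-v) = outside-span ¬cyclic in
    deduplicate-! _≟ᴱ_ candidates , x , v , generator∉cut x-generator , ¬inSpan-v ∘ cut⊆span ,
    λ walk → ¬inSpan-v (Any.map proj₂ (walk-from-generator walk x-generator))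

  -- φ N counts the unit multipliers, so at most N − φ N non-generators
  cut-length : length cut ≤ N ∸ φ N
  cut-length = begin
    length cut                    ≤⟨ length-deduplicate _≟ᴱ_ candidates ⟩
    length candidates             ≤⟨ length-filter (¬? ∘ generator?) nonUnitMultiples ⟩
    length nonUnitMultiples       ≡⟨ length-map (_• x) nonUnits ⟩
    length nonUnits               ≡⟨ m+n∸m≡n (φ N) (length nonUnits) ⟨
    φ N + length nonUnits ∸ φ N   ≡⟨ cong (_∸ φ N) (length-filter-complement unit? multipliers) ⟩
    length multipliers ∸ φ N      ≡⟨ cong (_∸ φ N) (trans (length-map suc (upTo N)) (length-upTo N)) ⟩
    N ∸ φ N                       ∎
    where open ≤-Reasoning

∣-^ : ∀ p e → 1 ≤ e → p ∣ p ^ e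
∣-^ p (suc e) _ = m∣m*n (p ^ e)

∣-resp-% : ∀ {d q} a b .{{_ : NonZero q}} → d ∣ q → a % q ≡ b % q → d ∣ a → d ∣ b
∣-resp-% a b d∣q a≡b d∣a = ∣n∣m%n⇒∣m d∣q (subst (_ ∣_) a≡b (%-presˡ-∣ d∣a d∣q))

-- The group of the theorem, Z_{p₁^{t₁₀}} × ⋯ (block i = the p_i-primary part),
-- and the element x whose coordinates are 1 in the first factor of each block
-- and 0 elsewhere.  x has order N = ∏ p_i^{t_i0}, and it is rigid because each
-- p_i-block of a generator of ⟨x⟩ has a unit first coordinate.
module PrimaryDecomposition (r : ℕ) (p : Fin r → ℕ) (kp : Fin r → ℕ)
    (t : (i : Fin r) → Fin (suc (kp i)) → ℕ)
    (prime : ∀ i → Prime (p i)) (t≥1 : ∀ i j → 1 ≤ t i j) where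

  q : (i : Fin r) → Fin (suc (kp i)) → ℕ
  q i j = p i ^ t i j

  block : Fin r → List ℕ
  block i = map (q i) (allFin (suc (kp i)))

  ms : List ℕ
  ms = concat (map block (allFin r))

  N : ℕ
  N = product (map (λ i → q i F.zero) (allFin r))

  instance
    q-nonZero : ∀ {i j} → NonZero (q i j)
    q-nonZero {i} {j} = m^n≢0 (p i) (t i j) {{prime⇒nonZero (prime i)}}

    N-nonZero : NonZero N
    N-nonZero = product≢0 (All.map⁺ (All.universal (λ _ → q-nonZero) (allFin r)))

  p>1 : ∀ i → 1 < p i
  p>1 i = nonTrivial⇒n>1 (p i) {{prime⇒nonTrivial (prime i)}}

  -- 1 in the first factor of block i, which is nontrivial as t_i0 ≥ 1
  one : (i : Fin r) → Fin (q i F.zero)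
  one i = fromℕ< (^-monoʳ-< (p i) (p>1 i) (t≥1 i F.zero))

  unitVector : (i : Fin r) → Elem (block i)
  unitVector i = one i , zeroᴱ _ (All.map⁺ (All.universal (λ _ → q-nonZero) _))

  x-on : (l : List (Fin r)) → Elem (concat (map block l))
  x-on []      = tt
  x-on (i ∷ l) = append (block i) (unitVector i) (x-on l)

  x : Elem ms
  x = x-on (allFin r)

  head∣N : ∀ i → q i F.zero ∣ N
  head∣N i = ∈⇒∣product (∈-map⁺ (λ i → q i F.zero) (∈-allFin i))

  p∣head : ∀ i → p i ∣ q i F.zero
  p∣head i = ∣-^ (p i) (t i F.zero) (t≥1 i F.zero)

  x-periodic : Periodic N x
  x-periodic = periodic-on (allFin r)
    where
    unitVector-periodic : ∀ i → Periodic N (unitVector i)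
    unitVector-periodic i n j = cong₂ _,_
      (mulFin-periodic N (head∣N i) (one i) n j)
      (trans (•-zeroᴱ _ _ (n + j * N)) (sym (•-zeroᴱ _ _ n)))
    periodic-on : ∀ l → Periodic N (x-on l)
    periodic-on []      n j = refl
    periodic-on (i ∷ l) =
      periodic-append (block i) N (unitVector i) (x-on l) (unitVector-periodic i) (periodic-on l)

  coprime-to-block : ∀ i {k} → ¬ p i ∣ k → All (Coprime k) (block i)
  coprime-to-block i {k} p∤k = All.map⁺ (All.universal {P = λ j → Coprime k (q i j)}
    (λ j → coprime-^ (∤-prime⇒coprime (prime i) p∤k) (t i j)) _)

  -- rigidity of one block: if k • w = m • unitVector i with m a unit modulo N,
  -- comparing first coordinates  k h ≡ m (mod p_i^{t_i0})  shows p_i ∤ k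
  unitVector-rigid : ∀ i k m (w : Elem (block i)) → k • w ≡ m • unitVector i → gcd m N ≡ 1 →
                     All (Coprime k) (block i)
  unitVector-rigid i k m (h , _) k•w≡m•e m⊥N = coprime-to-block i p∤k
    where
    first-coordinate : (k * toℕ h) % q i F.zero ≡ (m * 1) % q i F.zero
    first-coordinate = begin
      (k * toℕ h) % q i F.zero          ≡⟨ toℕ-mulFin k h ⟨
      toℕ (mulFin k h)                  ≡⟨ cong (toℕ ∘ proj₁) k•w≡m•e ⟩
      toℕ (mulFin m (one i))            ≡⟨ toℕ-mulFin m (one i) ⟩
      (m * toℕ (one i)) % q i F.zero    ≡⟨ cong (λ c → (m * c) % q i F.zero) (toℕ-fromℕ< _) ⟩
      (m * 1) % q i F.zero              ∎
      where open ≡-Reasoning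
    p∤k : ¬ p i ∣ k
    p∤k p∣k = <⇒≢ (p>1 i) (sym (gcd≡1⇒coprime m⊥N (p∣m , ∣-trans (p∣head i) (head∣N i))))
      where
      p∣m : p i ∣ m
      p∣m = subst (p i ∣_) (*-identityʳ m)
              (∣-resp-% (k * toℕ h) (m * 1) (p∣head i) first-coordinate (∣m⇒∣m*n (toℕ h) p∣k))

  x-rigid : ∀ k m w → k • w ≡ m • x → gcd m N ≡ 1 → Coprime k (product ms)
  x-rigid k m w k•w≡m•x m⊥N = coprime-product ms (rigid-on (allFin r) w k•w≡m•x)
    where
    rigid-on : ∀ l (w : Elem (concat (map block l))) → k • w ≡ m • x-on l →
               All (Coprime k) (concat (map block l))
    rigid-on []      w eq = []
    rigid-on (i ∷ l) w eq =
      All.++⁺ (unitVector-rigid i k m u (proj₁ parts) m⊥N) (rigid-on l v (proj₂ parts))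
      where
      u : Elem (block i)
      u = proj₁ (split (block i) w)
      v : Elem (concat (map block l))
      v = proj₂ (split (block i) w)
      parts : k • u ≡ m • unitVector i × k • v ≡ m • x-on l
      parts = append-injective (block i) (begin
        append (block i) (k • u) (k • v)   ≡⟨ •-append (block i) k u v ⟨
        k • append (block i) u v           ≡⟨ cong (k •_) (append-split (block i) w) ⟩
        k • w                              ≡⟨ eq ⟩
        m • x-on (i ∷ l)                   ≡⟨ •-append (block i) m (unitVector i) (x-on l) ⟩
        append (block i) (m • unitVector i) (m • x-on l) ∎)
        where open ≡-Reasoning

mainTheorem20 : (r : ℕ) (p : Fin r → ℕ) (kp : Fin r → ℕ) (t : (i : Fin r) → Fin (suc (kp i)) → ℕ) →
  (∀ i → Prime (p i)) →
  (∀ i j → p i ≡ p j → i ≡ j) →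
  (∀ i j → 1 ≤ t i j) →
  (∀ i (a b : Fin (suc (kp i))) → a F.≤ b → t i a ≤ t i b) →
  let ms = concat (map (λ i → map (λ j → p i ^ t i j) (allFin (suc (kp i)))) (allFin r))
      N  = product (map (λ i → p i ^ t i zero) (allFin r))
  in ¬ Cyclic ms →
     ∃[ κ ] (IsVertexConnectivity (PowerAdj {ms}) κ × κ ≤ N ∸ φ N)
mainTheorem20 r p kp t prime _ t≥1 _ ¬cyclic =
  let (κ , isConnectivity , κ≤cut) = connectivity-exists cut (cut-isVertexCut ¬cyclic)
  in κ , isConnectivity , ≤-trans κ≤cut cut-length
  where
  open PrimaryDecomposition r p kp t prime t≥1
  open CyclicSubgroupCut N x x-periodic x-rigid
  open FiniteGraph _≟ᴱ_ (elements ms) elements-complete PowerAdj powerAdj?
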